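{- Let $H$ be an $n$-vertex $3$-graph with $n\ge 7$ and $\delta_2(H)\ge 3$. Then for every vertex $u$ of $H$ there is a copy of $S_3$ in $H$ with center $u$, i.e. six distinct vertices $a_1,\dots,a_6$ different from $u$ such that $\{u,a_1,a_2\},\{u,a_3,a_4\},\{u,a_5,a_6\}$ are edges of $H$.
   Context: $\delta_2(H)$ is the minimum over pairs of vertices of the number of edges containing the pair. $S_3$ is the $3$-graph with edges $\{v_0,v_1,v_2\},\{v_0,v_3,v_4\},\{v_0,v_5,v_6\}$ on seven distinct vertices, with center $v_0$. -}

module Defs where

open import Data.Nat using (ℕ; _≥_)
open import Data.Fin using (Fin)
open import Data.Fin.Subset using (Subset; ⁅_⁆; _∪_; ∣_∣)
open import Data.Product using (Σ; _×_; ∃)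
open import Relation.Binary.PropositionalEquality using (_≡_; _≢_)
open import Level using (Level; suc; _⊔_)

record ThreeGraph (n : ℕ) : Set₁ where
  field
    Edge    : Subset n → Set
    uniform : ∀ e → Edge e → ∣ e ∣ ≡ 3

open ThreeGraph public

triple : ∀ {n} → Fin n → Fin n → Fin n → Subset n
triple x y z = ⁅ x ⁆ ∪ (⁅ y ⁆ ∪ ⁅ z ⁆)

-- The pair {x,y} (x ≠ y) lies in at least 3 edges: there are three distinct
-- vertices z₁ z₂ z₃ with {x,y,zᵢ} an edge (edges through {x,y} correspond
-- bijectively to such third vertices).
CodegreeAtLeast3 : ∀ {n} → ThreeGraph n → Fin n → Fin n → Set
CodegreeAtLeast3 H x y =
  Σ (Fin _) λ z₁ → Σ (Fin _) λ z₂ → Σ (Fin _) λ z₃ →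
    z₁ ≢ z₂ × z₁ ≢ z₃ × z₂ ≢ z₃ ×
    Edge H (triple x y z₁) × Edge H (triple x y z₂) × Edge H (triple x y z₃)

MinCodegree≥3 : ∀ {n} → ThreeGraph n → Set
MinCodegree≥3 H = ∀ x y → x ≢ y → CodegreeAtLeast3 H x y

HasS3At : ∀ {n} → ThreeGraph n → Fin n → Set
HasS3At {n} H u =
  Σ (Fin n) λ a₁ → Σ (Fin n) λ a₂ → Σ (Fin n) λ a₃ →
  Σ (Fin n) λ a₄ → Σ (Fin n) λ a₅ → Σ (Fin n) λ a₆ →
    (u ≢ a₁ × u ≢ a₂ × u ≢ a₃ × u ≢ a₄ × u ≢ a₅ × u ≢ a₆) ×
    (a₁ ≢ a₂ × a₁ ≢ a₃ × a₁ ≢ a₄ × a₁ ≢ a₅ × a₁ ≢ a₆) ×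
    (a₂ ≢ a₃ × a₂ ≢ a₄ × a₂ ≢ a₅ × a₂ ≢ a₆) ×
    (a₃ ≢ a₄ × a₃ ≢ a₅ × a₃ ≢ a₆) ×
    (a₄ ≢ a₅ × a₄ ≢ a₆) ×
    (a₅ ≢ a₆) ×
    Edge H (triple u a₁ a₂) × Edge H (triple u a₃ a₄) × Edge H (triple u a₅ a₆)

{-# OPTIONS --safe #-}
-- Fix u and let a ~ b mean that {u,a,b} is an edge (the link graph of u).  It is
-- loopless, δ₂(H) ≥ 3 says that every vertex other than u has three ~-neighbours, and
-- an S₃ centred at u is a matching of three ~-edges.  Greedily pick disjoint edges
-- ab, cd and two more vertices e, f outside {u,a,b,c,d}.  Either e has a neighbour
-- off {a,b,c,d}, or two of its three neighbours form a pair, say {a,b}; then a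
-- neighbour g ∉ {c,d} of f gives ab, cd, fg, or, if g ∈ {a,b}, e and f share out a, b.
module Submission where

open import Defs
open import Data.Nat using (ℕ; _≥_; _≤_; _<_; _+_; s≤s; z≤n; _<?_)
open import Data.Nat.Properties using (≤-trans; <-≤-trans; ≤-reflexive; +-suc; +-monoʳ-≤; n≤1+n; 1+n≰n)
open import Data.Fin using (Fin; _≟_)
open import Data.Fin.Properties using (¬∀⟶∃¬; <⇒notInjective)
open import Data.Fin.Subset using (Subset; ⁅_⁆; _∪_; ∣_∣; inside; outside)
open import Data.Fin.Subset.Properties using (∣⁅x⁆∣≡1; ∪-assoc; ∪-comm; ∪-idem)
open import Data.Vec using (_∷_; [])
open import Data.List using (List; length; lookup; _∷_; [])
open import Data.List.Membership.Propositional using (_∈_)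
open import Data.List.Relation.Unary.Any using (index; any?)
open import Data.List.Relation.Unary.Any.Properties using (lookup-index)
open import Data.List.Relation.Unary.All using (All; _∷_; [])
open import Data.List.Relation.Unary.All.Properties using (¬Any⇒All¬)
open import Data.Product using (Σ; _×_; _,_; ∃; proj₂; map₂)
open import Data.Sum using (_⊎_; inj₁; inj₂)
open import Data.Empty using (⊥; ⊥-elim)
open import Function using (_∘_)
open import Function.Definitions using (Injective)
open import Relation.Nullary using (yes; no)
open import Relation.Nullary.Decidable using (from-yes)
open import Relation.Binary.PropositionalEquality
  using (_≡_; _≢_; refl; sym; trans; cong; cong₂; ≢-sym)

∣p∪q∣≤∣p∣+∣q∣ : ∀ {n} (p q : Subset n) → ∣ p ∪ q ∣ ≤ ∣ p ∣ + ∣ q ∣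
∣p∪q∣≤∣p∣+∣q∣ []            []            = z≤n
∣p∪q∣≤∣p∣+∣q∣ (inside  ∷ p) (inside  ∷ q) =
  s≤s (≤-trans (∣p∪q∣≤∣p∣+∣q∣ p q) (+-monoʳ-≤ ∣ p ∣ (n≤1+n ∣ q ∣)))
∣p∪q∣≤∣p∣+∣q∣ (inside  ∷ p) (outside ∷ q) = s≤s (∣p∪q∣≤∣p∣+∣q∣ p q)
∣p∪q∣≤∣p∣+∣q∣ (outside ∷ p) (inside  ∷ q) =
  ≤-trans (s≤s (∣p∪q∣≤∣p∣+∣q∣ p q)) (≤-reflexive (sym (+-suc ∣ p ∣ ∣ q ∣)))
∣p∪q∣≤∣p∣+∣q∣ (outside ∷ p) (outside ∷ q) = ∣p∪q∣≤∣p∣+∣q∣ p q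

∃-∉ : ∀ {n} (xs : List (Fin n)) → length xs < n → ∃ λ v → All (v ≢_) xs
∃-∉ {n} xs |xs|<n = map₂ (¬Any⇒All¬ xs)
  (¬∀⟶∃¬ n (_∈ xs) (λ v → any? (v ≟_) xs) (<⇒notInjective |xs|<n ∘ index-injective))
  where
  -- the position of a vertex in xs would inject Fin n into Fin (length xs)
  index-injective : (covered : ∀ v → v ∈ xs) → Injective _≡_ _≡_ (index ∘ covered)
  index-injective covered {v} {w} eq =
    trans (lookup-index (covered v)) (trans (cong (lookup xs) eq) (sym (lookup-index (covered w))))

∣⁅x⁆∪⁅y⁆∣≤2 : ∀ {n} (x y : Fin n) → ∣ ⁅ x ⁆ ∪ ⁅ y ⁆ ∣ ≤ 2
∣⁅x⁆∪⁅y⁆∣≤2 x y = ≤-trans (∣p∪q∣≤∣p∣+∣q∣ ⁅ x ⁆ ⁅ y ⁆) (≤-reflexive (cong₂ _+_ (∣⁅x⁆∣≡1 x) (∣⁅x⁆∣≡1 y)))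

p∪[p∪q]≡p∪q : ∀ {n} (p q : Subset n) → p ∪ (p ∪ q) ≡ p ∪ q
p∪[p∪q]≡p∪q p q = trans (sym (∪-assoc p p q)) (cong (_∪ q) (∪-idem p))

∣triple∣≡3⇒distinct : ∀ {n} {x y z : Fin n} → ∣ triple x y z ∣ ≡ 3 → x ≢ y × x ≢ z × y ≢ z
∣triple∣≡3⇒distinct {x = x} {y} {z} ∣t∣≡3 = x≢y , x≢z , y≢z
  where
  not-a-pair : ∀ {p q} → triple x y z ≡ ⁅ p ⁆ ∪ ⁅ q ⁆ → ⊥
  not-a-pair {p} {q} eq =
    1+n≰n (≤-trans (≤-reflexive (trans (sym ∣t∣≡3) (cong ∣_∣ eq))) (∣⁅x⁆∪⁅y⁆∣≤2 p q))

  x≢y : x ≢ y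
  x≢y refl = not-a-pair (p∪[p∪q]≡p∪q ⁅ x ⁆ ⁅ z ⁆)

  x≢z : x ≢ z
  x≢z refl = not-a-pair (trans (cong (⁅ x ⁆ ∪_) (∪-comm ⁅ y ⁆ ⁅ x ⁆)) (p∪[p∪q]≡p∪q ⁅ x ⁆ ⁅ y ⁆))

  y≢z : y ≢ z
  y≢z refl = not-a-pair (cong (⁅ x ⁆ ∪_) (∪-idem ⁅ y ⁆))

Disjoint : ∀ {n} → Fin n → Fin n → Fin n → Fin n → Set
Disjoint a b c d = a ≢ c × a ≢ d × b ≢ c × b ≢ d

Disjoint-sym : ∀ {n} {a b c d : Fin n} → Disjoint a b c d → Disjoint c d a b
Disjoint-sym (a≢c , a≢d , b≢c , b≢d) = ≢-sym a≢c , ≢-sym b≢c , ≢-sym a≢d , ≢-sym b≢d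

data Side {n} (a b c d z : Fin n) : Set where
  left  : z ≡ a ⊎ z ≡ b → Side a b c d z
  right : z ≡ c ⊎ z ≡ d → Side a b c d z
  apart : z ≢ a → z ≢ b → z ≢ c → z ≢ d → Side a b c d z

side? : ∀ {n} (a b c d z : Fin n) → Side a b c d z
side? a b c d z with z ≟ a | z ≟ b | z ≟ c | z ≟ d
... | yes z≡a | _       | _       | _       = left (inj₁ z≡a)
... | no _    | yes z≡b | _       | _       = left (inj₂ z≡b)
... | no _    | no _    | yes z≡c | _       = right (inj₁ z≡c)
... | no _    | no _    | no _    | yes z≡d = right (inj₂ z≡d)
... | no z≢a  | no z≢b  | no z≢c  | no z≢d  = apart z≢a z≢b z≢c z≢d

module _ {n : ℕ} (_~_ : Fin n → Fin n → Set) where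

  ThreeNeighbours : Fin n → Set
  ThreeNeighbours x = Σ (Fin n) λ z₁ → Σ (Fin n) λ z₂ → Σ (Fin n) λ z₃ →
    z₁ ≢ z₂ × z₁ ≢ z₃ × z₂ ≢ z₃ × x ~ z₁ × x ~ z₂ × x ~ z₃

  data Matching₃ : Set where
    matching : ∀ {a b c d e f} → a ~ b → c ~ d → e ~ f →
      Disjoint a b c d → Disjoint a b e f → Disjoint c d e f → Matching₃

  neighbour-avoiding : ∀ {x} → ThreeNeighbours x → ∀ p q → ∃ λ g → x ~ g × g ≢ p × g ≢ q
  neighbour-avoiding (z₁ , z₂ , z₃ , z₁≢z₂ , z₁≢z₃ , z₂≢z₃ , x~z₁ , x~z₂ , x~z₃) p q
    with z₁ ≟ p | z₁ ≟ q | z₂ ≟ p | z₂ ≟ q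
  ... | no z₁≢p  | no z₁≢q | _        | _        = z₁ , x~z₁ , z₁≢p , z₁≢q
  ... | yes refl | _       | _        | no z₂≢q  = z₂ , x~z₂ , ≢-sym z₁≢z₂ , z₂≢q
  ... | yes refl | _       | _        | yes refl = z₃ , x~z₃ , ≢-sym z₁≢z₃ , ≢-sym z₂≢z₃
  ... | no _     | yes refl | no z₂≢p  | _       = z₂ , x~z₂ , z₂≢p , ≢-sym z₁≢z₂
  ... | no _     | yes refl | yes refl | _       = z₃ , x~z₃ , ≢-sym z₂≢z₃ , ≢-sym z₁≢z₃

  both-ends : ∀ {x z₁ z₂ a b} → z₁ ≢ z₂ → x ~ z₁ → x ~ z₂ →
    z₁ ≡ a ⊎ z₁ ≡ b → z₂ ≡ a ⊎ z₂ ≡ b → x ~ a × x ~ b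
  both-ends z₁≢z₂ x~z₁ x~z₂ (inj₁ refl) (inj₁ refl) = ⊥-elim (z₁≢z₂ refl)
  both-ends z₁≢z₂ x~z₁ x~z₂ (inj₁ refl) (inj₂ refl) = x~z₁ , x~z₂
  both-ends z₁≢z₂ x~z₁ x~z₂ (inj₂ refl) (inj₁ refl) = x~z₂ , x~z₁
  both-ends z₁≢z₂ x~z₁ x~z₂ (inj₂ refl) (inj₂ refl) = ⊥-elim (z₁≢z₂ refl)

  neighbour-apart-or-pair : ∀ {x} → ThreeNeighbours x → ∀ a b c d →
    (∃ λ g → x ~ g × g ≢ a × g ≢ b × g ≢ c × g ≢ d) ⊎ (x ~ a × x ~ b) ⊎ (x ~ c × x ~ d)
  neighbour-apart-or-pair (z₁ , z₂ , z₃ , z₁≢z₂ , z₁≢z₃ , z₂≢z₃ , x~z₁ , x~z₂ , x~z₃) a b c d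
    with side? a b c d z₁ | side? a b c d z₂ | side? a b c d z₃
  ... | apart p q r s | _             | _             = inj₁ (z₁ , x~z₁ , p , q , r , s)
  ... | _             | apart p q r s | _             = inj₁ (z₂ , x~z₂ , p , q , r , s)
  ... | _             | _             | apart p q r s = inj₁ (z₃ , x~z₃ , p , q , r , s)
  ... | left s₁  | left s₂  | _        = inj₂ (inj₁ (both-ends z₁≢z₂ x~z₁ x~z₂ s₁ s₂))
  ... | left s₁  | right _  | left s₃  = inj₂ (inj₁ (both-ends z₁≢z₃ x~z₁ x~z₃ s₁ s₃))
  ... | left _   | right s₂ | right s₃ = inj₂ (inj₂ (both-ends z₂≢z₃ x~z₂ x~z₃ s₂ s₃))
  ... | right _  | left s₂  | left s₃  = inj₂ (inj₁ (both-ends z₂≢z₃ x~z₂ x~z₃ s₂ s₃))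
  ... | right s₁ | left _   | right s₃ = inj₂ (inj₂ (both-ends z₁≢z₃ x~z₁ x~z₃ s₁ s₃))
  ... | right s₁ | right s₂ | _        = inj₂ (inj₂ (both-ends z₁≢z₂ x~z₁ x~z₂ s₁ s₂))

  module _ (loopless : ∀ {x y} → x ~ y → x ≢ y) where

    rematch : ∀ {a b c d e f} → a ~ b → c ~ d → Disjoint a b c d → e ~ a → e ~ b →
      All (e ≢_) (a ∷ b ∷ c ∷ d ∷ []) → All (f ≢_) (a ∷ b ∷ c ∷ d ∷ e ∷ []) →
      ThreeNeighbours f → Matching₃
    rematch {a} {b} {c} {d} a~b c~d ab#cd@(a≢c , a≢d , b≢c , b≢d) e~a e~b
      (e≢a ∷ e≢b ∷ e≢c ∷ e≢d ∷ []) (f≢a ∷ f≢b ∷ f≢c ∷ f≢d ∷ f≢e ∷ []) Nf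
      with neighbour-avoiding Nf c d
    ... | g , f~g , g≢c , g≢d with g ≟ a | g ≟ b
    ... | yes refl | _        = matching e~b f~g c~d
            (≢-sym f≢e , e≢a , ≢-sym f≢b , ≢-sym (loopless a~b))
            (e≢c , e≢d , b≢c , b≢d) (f≢c , f≢d , a≢c , a≢d)
    ... | no _     | yes refl = matching e~a f~g c~d
            (≢-sym f≢e , e≢b , ≢-sym f≢a , loopless a~b)
            (e≢c , e≢d , a≢c , a≢d) (f≢c , f≢d , b≢c , b≢d)
    ... | no g≢a   | no g≢b   = matching a~b c~d f~g ab#cd
            (≢-sym f≢a , ≢-sym g≢a , ≢-sym f≢b , ≢-sym g≢b)
            (≢-sym f≢c , ≢-sym g≢c , ≢-sym f≢d , ≢-sym g≢d)

    extend : ∀ {a b c d e f} → a ~ b → c ~ d → Disjoint a b c d →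
      All (e ≢_) (a ∷ b ∷ c ∷ d ∷ []) → ThreeNeighbours e →
      All (f ≢_) (a ∷ b ∷ c ∷ d ∷ e ∷ []) → ThreeNeighbours f → Matching₃
    extend {a} {b} {c} {d} a~b c~d ab#cd e∉@(e≢a ∷ e≢b ∷ e≢c ∷ e≢d ∷ []) Ne
      f∉@(f≢a ∷ f≢b ∷ f≢c ∷ f≢d ∷ f≢e ∷ []) Nf
      with neighbour-apart-or-pair Ne a b c d
    ... | inj₁ (g , e~g , g≢a , g≢b , g≢c , g≢d) = matching a~b c~d e~g ab#cd
            (≢-sym e≢a , ≢-sym g≢a , ≢-sym e≢b , ≢-sym g≢b)
            (≢-sym e≢c , ≢-sym g≢c , ≢-sym e≢d , ≢-sym g≢d)
    ... | inj₂ (inj₁ (e~a , e~b)) = rematch a~b c~d ab#cd e~a e~b e∉ f∉ Nf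
    ... | inj₂ (inj₂ (e~c , e~d)) = rematch c~d a~b (Disjoint-sym ab#cd) e~c e~d
            (e≢c ∷ e≢d ∷ e≢a ∷ e≢b ∷ []) (f≢c ∷ f≢d ∷ f≢a ∷ f≢b ∷ f≢e ∷ []) Nf

    matching₃ : ∀ u → (∀ x → u ≢ x → ThreeNeighbours x) → 7 ≤ n → Matching₃
    matching₃ u deg 7≤n
      with a , a≢u ∷ [] ← ∃-∉ (u ∷ []) (<-≤-trans (from-yes (1 <? 7)) 7≤n)
      with b , _ , _ , _ , _ , _ , a~b , _ ← deg a (≢-sym a≢u)
      with c , c≢u ∷ c≢a ∷ c≢b ∷ [] ← ∃-∉ (u ∷ a ∷ b ∷ []) (<-≤-trans (from-yes (3 <? 7)) 7≤n)
      with d , c~d , d≢a , d≢b ← neighbour-avoiding (deg c (≢-sym c≢u)) a b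
      with e , e≢u ∷ e∉ ← ∃-∉ (u ∷ a ∷ b ∷ c ∷ d ∷ []) (<-≤-trans (from-yes (5 <? 7)) 7≤n)
      with f , f≢u ∷ f∉ ← ∃-∉ (u ∷ a ∷ b ∷ c ∷ d ∷ e ∷ []) (<-≤-trans (from-yes (6 <? 7)) 7≤n)
      = extend a~b c~d (≢-sym c≢a , ≢-sym d≢a , ≢-sym c≢b , ≢-sym d≢b)
          e∉ (deg e (≢-sym e≢u)) f∉ (deg f (≢-sym f≢u))

Link : ∀ {n} → ThreeGraph n → Fin n → Fin n → Fin n → Set
Link H u a b = Edge H (triple u a b)

link-distinct : ∀ {n} (H : ThreeGraph n) {u a b : Fin n} → Link H u a b → u ≢ a × u ≢ b × a ≢ b
link-distinct H e = ∣triple∣≡3⇒distinct (uniform H _ e)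

matching⇒S3 : ∀ {n} (H : ThreeGraph n) {u : Fin n} → Matching₃ (Link H u) → HasS3At H u
matching⇒S3 H (matching e₁₂ e₃₄ e₅₆
    (n₁₃ , n₁₄ , n₂₃ , n₂₄) (n₁₅ , n₁₆ , n₂₅ , n₂₆) (n₃₅ , n₃₆ , n₄₅ , n₄₆))
  with u≢a₁ , u≢a₂ , n₁₂ ← link-distinct H e₁₂
  with u≢a₃ , u≢a₄ , n₃₄ ← link-distinct H e₃₄
  with u≢a₅ , u≢a₆ , n₅₆ ← link-distinct H e₅₆
  = _ , _ , _ , _ , _ , _ , (u≢a₁ , u≢a₂ , u≢a₃ , u≢a₄ , u≢a₅ , u≢a₆) ,
    (n₁₂ , n₁₃ , n₁₄ , n₁₅ , n₁₆) , (n₂₃ , n₂₄ , n₂₅ , n₂₆) , (n₃₄ , n₃₅ , n₃₆) ,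
    (n₄₅ , n₄₆) , n₅₆ , e₁₂ , e₃₄ , e₅₆

theorem8 : (n : ℕ) → n ≥ 7 → (H : ThreeGraph n) → MinCodegree≥3 H →
    (u : Fin n) → HasS3At H u
theorem8 n n≥7 H δ₂≥3 u =
  matching⇒S3 H (matching₃ (Link H u) (λ e → proj₂ (proj₂ (link-distinct H e))) u (δ₂≥3 u) n≥7)
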